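{- Let $k\ge 1$ be an integer. If a finite simple graph $G$ is strongly $k$-choosable, then it is also strongly $km$-choosable for every positive integer $m$.
   Context: A graph is $n$-choosable if for every assignment of sets $S(v)$ of size $n$ to its vertices there is a proper vertex colouring assigning each vertex $v$ a colour from $S(v)$. A graph $G=(V,E)$ is strongly $n$-choosable if for every collection $V_1,\dots,V_r$ of pairwise disjoint subsets of $V$, each of size at most $n$, the graph obtained from $G$ by adding all edges between distinct vertices within each $V_i$ is $n$-choosable. -}

module Defs where

open import Data.Nat using (ℕ; _≤_; _*_; suc)
open import Data.Fin using (Fin)
open import Data.Fin.Subset using (Subset; _∈_; ∣_∣)
open import Data.List using (List; length)
open import Data.List.Relation.Unary.Unique.Propositional using (Unique)
import Data.List.Membership.Propositional as LM
open import Data.Product using (Σ; _×_; ∃)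
open import Data.Sum using (_⊎_)
open import Relation.Binary.PropositionalEquality using (_≡_; _≢_)
open import Relation.Nullary using (¬_)
open import Level using (0ℓ)

record Graph : Set₁ where
  field
    N     : ℕ
    Adj   : Fin N → Fin N → Set
    sym   : ∀ {u v} → Adj u v → Adj v u
    irrefl : ∀ {v} → ¬ Adj v v
open Graph public

IsListAssignment : ∀ {V : Set} → ℕ → (V → List ℕ) → Set
IsListAssignment {V} n S = ∀ (v : V) → Unique (S v) × length (S v) ≡ n

Choosable : (N : ℕ) → (Fin N → Fin N → Set) → ℕ → Set
Choosable N A n =
  (S : Fin N → List ℕ) → IsListAssignment n S →
  Σ (Fin N → ℕ) λ c →
    (∀ v → c v LM.∈ S v) × (∀ u v → A u v → c u ≢ c v)

_-Choosable_ : ℕ → Graph → Set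
n -Choosable G = Choosable (N G) (Adj G) n

AddCliques : (G : Graph) {r : ℕ} → (Fin r → Subset (N G)) → Fin (N G) → Fin (N G) → Set
AddCliques G V u v =
  Adj G u v ⊎ (u ≢ v × ∃ λ i → (u ∈ V i) × (v ∈ V i))

Admissible : (G : Graph) → ℕ → {r : ℕ} → (Fin r → Subset (N G)) → Set
Admissible G n {r} V =
  (∀ i j → i ≢ j → ∀ x → x ∈ V i → ¬ (x ∈ V j)) × (∀ i → ∣ V i ∣ ≤ n)

StronglyChoosable : ℕ → Graph → Set
StronglyChoosable n G =
  (r : ℕ) (V : Fin r → Subset (N G)) → Admissible G n V →
  Choosable (N G) (AddCliques G V) n

-- Let V be one of the disjoint blocks, with ∣ V ∣ ≤ k * m, and let every vertex have a
-- list of k * m colours. We cut V into m parts of at most k vertices and give each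
-- vertex k of its colours so that vertices in different parts get disjoint colours.
-- One part is peeled off at a time: for t = ∣ V ∣ ∸ k * (m - 1) choose a colour
-- threshold T and t vertices each having at least k colours below T, while every
-- other vertex of V has at most k colours below T. The chosen vertices form a part
-- and use colours below T; the others keep at least k * (m - 1) colours from T on.
-- The parts of all blocks form an admissible family with blocks of size at most k,
-- so strong k-choosability colours G from the chosen k-sets: two vertices of a block
-- either share a part, and are then in a common new block, or have disjoint colours.

module Submission where

open import Defs hiding (sym)
open import Data.Nat using (ℕ; zero; suc; _+_; _*_; _∸_; _≤_; _<_; _≥_; z≤n; s≤s)
open import Data.Nat.Properties
open import Data.Fin using (Fin; zero; suc; remQuot; combine)
open import Data.Fin.Properties using (any?; remQuot-combine; combine-remQuot)
  renaming (_≟_ to _≟ᶠ_; suc-injective to suc-injectiveᶠ)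
open import Data.Fin.Subset using (Subset; inside; outside; _∈_; _∉_; _⊆_; _∩_; _─_; ∣_∣; ⊥)
open import Data.Fin.Subset.Properties
  using ( _∈?_; drop-∷-⊆; s⊆s; out⊆; ⊆-refl; p⊆q⇒∣p∣≤∣q∣; p∩q⊆p; x∈p∩q⁺; x∈p∩q⁻
        ; p─q⊆p; x∈p∧x∉q⇒x∈p─q; ∣⊥∣≡0)
open import Data.Vec using (_∷_; []; here; there; tabulate)
open import Data.Vec.Properties using (lookup∘tabulate; []=⇒lookup; lookup⇒[]=)
open import Data.List using (List; []; _∷_; length; take; filter)
open import Data.List.Properties
  using (length-take; take++drop≡id; filter-accept; filter-reject; filter-all; filter-none)
open import Data.List.Extrema.Nat using (max; xs≤max; ⊥≤max)
open import Data.List.Membership.Propositional using () renaming (_∈_ to _∈ₗ_)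
open import Data.List.Membership.Propositional.Properties using (∈-++⁺ˡ; ∈-filter⁻)
open import Data.List.Relation.Binary.Subset.Propositional using () renaming (_⊆_ to _⊆ₗ_)
open import Data.List.Relation.Binary.Subset.Propositional.Properties using (filter-⊆)
open import Data.List.Relation.Binary.Disjoint.Propositional using (Disjoint)
open import Data.List.Relation.Unary.All as All using (All; []; _∷_)
open import Data.List.Relation.Unary.Unique.Propositional using (Unique; []; _∷_)
open import Data.List.Relation.Unary.Unique.Propositional.Properties using (take⁺; filter⁺)
open import Data.Product using (Σ; ∃-syntax; _×_; _,_; proj₁; proj₂; uncurry)
import Data.Product as Product
open import Data.Sum using (_⊎_; inj₁; inj₂; [_,_]′)
open import Data.Empty using (⊥-elim)
open import Function using (_∘_)
open import Level using (Level)
open import Relation.Binary using (tri<; tri≈; tri>)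
open import Relation.Binary.PropositionalEquality
open import Relation.Nullary using (¬_; yes; no; does)
open import Relation.Nullary.Decidable using (dec-true)
open import Relation.Unary using (Pred; Decidable)
open import Relation.Unary.Properties using (∁?)

private
  variable
    ℓ : Level
    n : ℕ
    x : Fin n

select : {P : Pred (Fin n) ℓ} → Decidable P → Subset n
select P? = tabulate (does ∘ P?)

module _ {P : Pred (Fin n) ℓ} (P? : Decidable P) where

  ∈-select⁺ : P x → x ∈ select P?
  ∈-select⁺ {x = x} px = lookup⇒[]= x _ (trans (lookup∘tabulate (does ∘ P?) x) (dec-true (P? x) px))

  ∈-select⁻ : x ∈ select P? → P x
  ∈-select⁻ {x = x} x∈ with P? x | trans (sym (lookup∘tabulate (does ∘ P?) x)) ([]=⇒lookup x∈)
  ... | yes px | _ = px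
  ... | no _   | ()

x∈p─q⇒x∉q : ∀ (p q : Subset n) → x ∈ p ─ q → x ∉ q
x∈p─q⇒x∉q (_ ∷ p) (_ ∷ q) (there x∈p─q) (there x∈q) = x∈p─q⇒x∉q p q x∈p─q x∈q

∣p─q∣+∣q∣≡∣p∣ : ∀ (p q : Subset n) → q ⊆ p → ∣ p ─ q ∣ + ∣ q ∣ ≡ ∣ p ∣
∣p─q∣+∣q∣≡∣p∣ []            []            _   = refl
∣p─q∣+∣q∣≡∣p∣ (inside  ∷ p) (outside ∷ q) q⊆p = cong suc (∣p─q∣+∣q∣≡∣p∣ p q (drop-∷-⊆ q⊆p))
∣p─q∣+∣q∣≡∣p∣ (outside ∷ p) (outside ∷ q) q⊆p = ∣p─q∣+∣q∣≡∣p∣ p q (drop-∷-⊆ q⊆p)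
∣p─q∣+∣q∣≡∣p∣ (inside  ∷ p) (inside  ∷ q) q⊆p =
  trans (+-suc ∣ p ─ q ∣ ∣ q ∣) (cong suc (∣p─q∣+∣q∣≡∣p∣ p q (drop-∷-⊆ q⊆p)))
∣p─q∣+∣q∣≡∣p∣ (outside ∷ p) (inside  ∷ q) q⊆p with q⊆p here
... | ()

⊆-interpolate : ∀ {p q : Subset n} {s} → p ⊆ q → ∣ p ∣ ≤ s → s ≤ ∣ q ∣ →
                ∃[ r ] p ⊆ r × r ⊆ q × ∣ r ∣ ≡ s
⊆-interpolate {p = []} {[]} _ _ s≤0 = [] , ⊆-refl , ⊆-refl , sym (n≤0⇒n≡0 s≤0)
⊆-interpolate {p = inside ∷ p} {outside ∷ q} p⊆q _ _ with p⊆q here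
... | ()
⊆-interpolate {p = inside ∷ p} {inside ∷ q} p⊆q (s≤s p≤s) (s≤s s≤q)
  with r , p⊆r , r⊆q , ∣r∣≡s ← ⊆-interpolate (drop-∷-⊆ p⊆q) p≤s s≤q
  = inside ∷ r , s⊆s p⊆r , s⊆s r⊆q , cong suc ∣r∣≡s
⊆-interpolate {p = outside ∷ p} {outside ∷ q} p⊆q p≤s s≤q
  with r , p⊆r , r⊆q , ∣r∣≡s ← ⊆-interpolate (drop-∷-⊆ p⊆q) p≤s s≤q
  = outside ∷ r , s⊆s p⊆r , s⊆s r⊆q , ∣r∣≡s
⊆-interpolate {p = outside ∷ p} {inside ∷ q} {s} p⊆q p≤s s≤1+q with s ≤? ∣ q ∣
... | yes s≤q with r , p⊆r , r⊆q , ∣r∣≡s ← ⊆-interpolate (drop-∷-⊆ p⊆q) p≤s s≤q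
  = outside ∷ r , s⊆s p⊆r , out⊆ r⊆q , ∣r∣≡s
... | no s≰q = inside ∷ q , p⊆q , ⊆-refl , ≤-antisym (≰⇒> s≰q) s≤1+q

remQuot-injective : ∀ {n} k {i j : Fin (n * k)} → remQuot {n} k i ≡ remQuot k j → i ≡ j
remQuot-injective {n} k {i} {j} e =
  trans (sym (combine-remQuot {n} k i)) (trans (cong (uncurry combine) e) (combine-remQuot {n} k j))

crossing : (a b : ℕ → ℕ) {t : ℕ} → (∀ T → b (suc T) ≤ a T) → b 0 ≤ t →
           ∀ M → t ≤ a M → ∃[ T ] b T ≤ t × t ≤ a T
crossing a b step b₀≤t zero    t≤a = 0 , b₀≤t , t≤a
crossing a b {t} step b₀≤t (suc M) t≤a with b (suc M) ≤? t
... | yes b≤t = suc M , b≤t , t≤a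
... | no  b≰t = crossing a b step b₀≤t M (≤-trans (<⇒≤ (≰⇒> b≰t)) (step M))

below : ℕ → List ℕ → List ℕ
below T = filter (_<? T)

below-zero : ∀ xs → below 0 xs ≡ []
below-zero xs = filter-none (_<? 0) (All.universal (λ _ ()) xs)

below-suc : ∀ T {xs} → All (T ≢_) xs → below (suc T) xs ≡ below T xs
below-suc T {[]}     []            = refl
below-suc T {x ∷ xs} (T≢x ∷ T∉xs) with <-cmp x T
... | tri< x<T _ _ rewrite filter-accept (_<? suc T) {xs = xs} (m<n⇒m<1+n x<T)
                         | filter-accept (_<? T) {xs = xs} x<T = cong (x ∷_) (below-suc T T∉xs)
... | tri≈ _ x≡T _ = ⊥-elim (T≢x (sym x≡T))
... | tri> _ _ T<x rewrite filter-reject (_<? suc T) {xs = xs} (<⇒≱ (s≤s T<x))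
                         | filter-reject (_<? T) {xs = xs} (<⇒≱ (m<n⇒m<1+n T<x)) = below-suc T T∉xs

length-below-suc : ∀ T {xs} → Unique xs → length (below (suc T) xs) ≤ suc (length (below T xs))
length-below-suc T {[]}     []            = z≤n
length-below-suc T {x ∷ xs} (x∉xs ∷ u) with <-cmp x T
... | tri< x<T _ _ rewrite filter-accept (_<? suc T) {xs = xs} (m<n⇒m<1+n x<T)
                         | filter-accept (_<? T) {xs = xs} x<T = s≤s (length-below-suc T u)
... | tri≈ _ refl _ rewrite filter-accept (_<? suc x) {xs = xs} (n<1+n x)
                          | filter-reject (_<? x) {xs = xs} (n≮n x)
                          | below-suc x x∉xs = ≤-refl
... | tri> _ _ T<x rewrite filter-reject (_<? suc T) {xs = xs} (<⇒≱ (s≤s T<x))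
                         | filter-reject (_<? T) {xs = xs} (<⇒≱ (m<n⇒m<1+n T<x)) =
  length-below-suc T u

length-filter-∁ : ∀ {a} {A : Set a} {P : Pred A ℓ} (P? : Decidable P) xs →
                  length (filter P? xs) + length (filter (∁? P?) xs) ≡ length xs
length-filter-∁ P? []       = refl
length-filter-∁ P? (x ∷ xs) with P? x
... | yes _ = cong suc (length-filter-∁ P? xs)
... | no  _ = trans (+-suc _ _) (cong suc (length-filter-∁ P? xs))

colour-bound : ∀ {N} (L : Fin N → List ℕ) → ∃[ M ] ∀ v → All (_< M) (L v)
colour-bound {zero}  L = 0 , λ ()
colour-bound {suc N} L with M , L<M ← colour-bound (L ∘ suc) = suc (max M (L zero)) , bounded
  where
  bounded : ∀ v → All (_< suc (max M (L zero))) (L v)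
  bounded zero    = All.map s≤s (xs≤max M (L zero))
  bounded (suc v) = All.map (λ c<M → ≤-trans c<M (m≤n⇒m≤1+n (⊥≤max M (L zero)))) (L<M v)

IsKSubset : ℕ → List ℕ → List ℕ → Set
IsKSubset k ys xs = (Unique ys × length ys ≡ k) × ys ⊆ₗ xs

take-⊆ : ∀ k (xs : List ℕ) → take k xs ⊆ₗ xs
take-⊆ k xs c∈ = subst (_ ∈ₗ_) (take++drop≡id k xs) (∈-++⁺ˡ c∈)

take-isKSubset : ∀ k {xs} → k ≤ length xs → Unique xs → IsKSubset k (take k xs) xs
take-isKSubset k {xs} k≤∣xs∣ u =
  (take⁺ k u , trans (length-take k xs) (m≤n⇒m⊓n≡m k≤∣xs∣)) , take-⊆ k xs

isKSubset-⊆ : ∀ {k xs ys zs} → xs ⊆ₗ zs → IsKSubset k ys xs → IsKSubset k ys zs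
isKSubset-⊆ xs⊆zs = Product.map₂ (xs⊆zs ∘_)

record Threshold (k : ℕ) {N : ℕ} (L : Fin N → List ℕ) (P : Subset N) (t : ℕ) : Set where
  field
    T     : ℕ
    X     : Subset N
    X⊆P   : X ⊆ P
    ∣X∣≡t : ∣ X ∣ ≡ t
    rich  : ∀ {v} → v ∈ X → k ≤ length (below T (L v))
    poor  : ∀ {v} → v ∈ P → v ∉ X → length (below T (L v)) ≤ k

-- Let A T and B T be the vertices of P with at least k, resp. more than k, colours
-- below T. Lists are duplicate-free, so B (suc T) ⊆ A T; hence ∣ B T ∣ ≤ t ≤ ∣ A T ∣
-- for some T, and X is any t-set between B T and A T.
-- The construction is opaque so that with-abstractions over v ∈? X below do not unfold it.
opaque
  threshold : ∀ k {N} (L : Fin N → List ℕ) (P : Subset N) →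
              (∀ {v} → v ∈ P → Unique (L v) × k ≤ length (L v)) →
              ∀ {t} → t ≤ ∣ P ∣ → Threshold k L P t
  threshold k {N} L P hL {t} t≤∣P∣ =
    build (crossing (∣_∣ ∘ A) (∣_∣ ∘ B) (λ T → p⊆q⇒∣p∣≤∣q∣ (B-suc⊆A T)) ∣B₀∣≤t
                    M (≤-trans t≤∣P∣ (p⊆q⇒∣p∣≤∣q∣ P⊆A-M)))
    where
    count : ℕ → Fin N → ℕ
    count T v = length (below T (L v))

    atLeast : ℕ → ℕ → Subset N
    atLeast j T = P ∩ select (λ v → j ≤? count T v)

    ∈-atLeast⁻ : ∀ j T {v} → v ∈ atLeast j T → v ∈ P × j ≤ count T v
    ∈-atLeast⁻ j T = Product.map₂ (∈-select⁻ (λ v → j ≤? count T v)) ∘ x∈p∩q⁻ P _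

    ∈-atLeast⁺ : ∀ j T {v} → v ∈ P → j ≤ count T v → v ∈ atLeast j T
    ∈-atLeast⁺ j T v∈P j≤ = x∈p∩q⁺ (v∈P , ∈-select⁺ (λ v → j ≤? count T v) j≤)

    A B : ℕ → Subset N
    A = atLeast k
    B = atLeast (suc k)

    B⊆A : ∀ T → B T ⊆ A T
    B⊆A T v∈B with v∈P , k<c ← ∈-atLeast⁻ (suc k) T v∈B = ∈-atLeast⁺ k T v∈P (<⇒≤ k<c)

    B-suc⊆A : ∀ T → B (suc T) ⊆ A T
    B-suc⊆A T {v} v∈B with v∈P , k<c ← ∈-atLeast⁻ (suc k) (suc T) v∈B =
      ∈-atLeast⁺ k T v∈P (≤-pred (≤-trans k<c (length-below-suc T (proj₁ (hL v∈P)))))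

    ∣B₀∣≤t : ∣ B 0 ∣ ≤ t
    ∣B₀∣≤t = ≤-trans (p⊆q⇒∣p∣≤∣q∣ B₀⊆⊥) (≤-trans (≤-reflexive (∣⊥∣≡0 N)) z≤n)
      where
      B₀⊆⊥ : B 0 ⊆ ⊥
      B₀⊆⊥ {v} v∈B with _ , k<c ← ∈-atLeast⁻ (suc k) 0 v∈B
        rewrite below-zero (L v) with () ← k<c

    M : ℕ
    M = proj₁ (colour-bound L)

    P⊆A-M : P ⊆ A M
    P⊆A-M {v} v∈P = ∈-atLeast⁺ k M v∈P (subst (k ≤_) (cong length (sym below-M)) (proj₂ (hL v∈P)))
      where
      below-M : below M (L v) ≡ L v
      below-M = filter-all (_<? M) (proj₂ (colour-bound L) v)

    build : ∃[ T ] ∣ B T ∣ ≤ t × t ≤ ∣ A T ∣ → Threshold k L P t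
    build (T , ∣B∣≤t , t≤∣A∣)
      with X , B⊆X , X⊆A , ∣X∣≡t ← ⊆-interpolate (B⊆A T) ∣B∣≤t t≤∣A∣ = record
      { T     = T
      ; X     = X
      ; X⊆P   = proj₁ ∘ ∈-atLeast⁻ k T ∘ X⊆A
      ; ∣X∣≡t = ∣X∣≡t
      ; rich  = proj₂ ∘ ∈-atLeast⁻ k T ∘ X⊆A
      ; poor  = λ v∈P v∉X → ≮⇒≥ (v∉X ∘ B⊆X ∘ ∈-atLeast⁺ (suc k) T v∈P)
      }

record Splitting (k m : ℕ) {N : ℕ} (L : Fin N → List ℕ) (P : Subset N) : Set where
  field
    part              : Fin N → Fin m
    sublist           : Fin N → List ℕ
    part-small        : ∀ j → ∣ P ∩ select (λ v → part v ≟ᶠ j) ∣ ≤ k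
    sublist-isKSubset : ∀ {v} → v ∈ P → IsKSubset k (sublist v) (L v)
    sublist-disjoint  : ∀ {u v} → u ∈ P → v ∈ P → part u ≢ part v →
                        Disjoint (sublist u) (sublist v)

split : ∀ k m {N} (L : Fin N → List ℕ) (P : Subset N) → ∣ P ∣ ≤ k * suc m →
        (∀ {v} → v ∈ P → Unique (L v) × k * suc m ≤ length (L v)) → Splitting k (suc m) L P
split k zero L P ∣P∣≤k*1 hL = record
  { part              = λ _ → zero
  ; sublist           = λ v → take k (L v)
  ; part-small        = λ _ → ≤-trans (p⊆q⇒∣p∣≤∣q∣ (p∩q⊆p P _))
                                      (≤-trans ∣P∣≤k*1 (≤-reflexive (*-identityʳ k)))
  ; sublist-isKSubset = λ v∈P → take-isKSubset k (≤-trans (m≤m*n k 1) (proj₂ (hL v∈P)))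
                                                (proj₁ (hL v∈P))
  ; sublist-disjoint  = λ _ _ 0≢0 → ⊥-elim (0≢0 refl)
  }
split k (suc m) {N} L P ∣P∣≤ hL = record
  { part              = part
  ; sublist           = sublist
  ; part-small        = part-small
  ; sublist-isKSubset = sublist-isKSubset
  ; sublist-disjoint  = sublist-disjoint
  }
  where
  km : ℕ
  km = k * suc m

  open Threshold
    (threshold k L P (Product.map₂ (≤-trans (m≤m*n k (suc (suc m)))) ∘ hL) (m∸n≤m ∣ P ∣ km))

  R : Subset N
  R = P ─ X

  ∈R : ∀ {v} → v ∈ P → v ∉ X → v ∈ R
  ∈R = x∈p∧x∉q⇒x∈p─q

  above : Fin N → List ℕ
  above v = filter (∁? (_<? T)) (L v)

  ∣R∣≤km : ∣ R ∣ ≤ km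
  ∣R∣≤km = +-cancelʳ-≤ ∣ X ∣ ∣ R ∣ km (begin
    ∣ R ∣ + ∣ X ∣          ≡⟨ ∣p─q∣+∣q∣≡∣p∣ P X X⊆P ⟩
    ∣ P ∣                 ≤⟨ m≤n+m∸n ∣ P ∣ km ⟩
    km + (∣ P ∣ ∸ km)     ≡⟨ cong (km +_) ∣X∣≡t ⟨
    km + ∣ X ∣             ∎)
    where open ≤-Reasoning

  hR : ∀ {v} → v ∈ R → Unique (above v) × km ≤ length (above v)
  hR {v} v∈R = filter⁺ (∁? (_<? T)) (proj₁ (hL v∈P)) , +-cancelˡ-≤ k km (length (above v)) (begin
    k + km                                       ≡⟨ *-suc k (suc m) ⟨
    k * suc (suc m)                              ≤⟨ proj₂ (hL v∈P) ⟩
    length (L v)                                 ≡⟨ length-filter-∁ (_<? T) (L v) ⟨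
    length (below T (L v)) + length (above v)    ≤⟨ +-monoˡ-≤ _ (poor v∈P (x∈p─q⇒x∉q P X v∈R)) ⟩
    k + length (above v)                         ∎)
    where
    open ≤-Reasoning
    v∈P : v ∈ P
    v∈P = p─q⊆p P X v∈R

  module Rest = Splitting (split k m above R ∣R∣≤km hR)

  part : Fin N → Fin (suc (suc m))
  part v with v ∈? X
  ... | yes _ = zero
  ... | no  _ = suc (Rest.part v)

  sublist : Fin N → List ℕ
  sublist v with v ∈? X
  ... | yes _ = take k (below T (L v))
  ... | no  _ = Rest.sublist v

  part-small : ∀ j → ∣ P ∩ select (λ v → part v ≟ᶠ j) ∣ ≤ k
  part-small zero = begin
    ∣ P ∩ select (λ v → part v ≟ᶠ zero) ∣ ≤⟨ p⊆q⇒∣p∣≤∣q∣ in-X ⟩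
    ∣ X ∣                                ≡⟨ ∣X∣≡t ⟩
    ∣ P ∣ ∸ km                           ≤⟨ m≤n+o⇒m∸n≤o ∣ P ∣ km ∣P∣≤km+k ⟩
    k                                    ∎
    where
    open ≤-Reasoning
    ∣P∣≤km+k : ∣ P ∣ ≤ km + k
    ∣P∣≤km+k = ≤-trans ∣P∣≤ (≤-reflexive (trans (*-suc k (suc m)) (+-comm k km)))
    in-X : P ∩ select (λ v → part v ≟ᶠ zero) ⊆ X
    in-X {v} v∈ with v ∈? X | ∈-select⁻ (λ v → part v ≟ᶠ zero) (proj₂ (x∈p∩q⁻ P _ v∈))
    ... | yes v∈X | _  = v∈X
    ... | no  _   | ()
  part-small (suc j) = ≤-trans (p⊆q⇒∣p∣≤∣q∣ in-rest) (Rest.part-small j)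
    where
    in-rest : P ∩ select (λ v → part v ≟ᶠ suc j) ⊆ R ∩ select (λ v → Rest.part v ≟ᶠ j)
    in-rest {v} v∈ with v∈P , in-j ← x∈p∩q⁻ P _ v∈
      with v ∈? X | ∈-select⁻ (λ v → part v ≟ᶠ suc j) in-j
    ... | yes _   | ()
    ... | no  v∉X | e =
      x∈p∩q⁺ (∈R v∈P v∉X , ∈-select⁺ (λ v → Rest.part v ≟ᶠ j) (suc-injectiveᶠ e))

  sublist-isKSubset : ∀ {v} → v ∈ P → IsKSubset k (sublist v) (L v)
  sublist-isKSubset {v} v∈P with v ∈? X
  ... | yes v∈X = isKSubset-⊆ (filter-⊆ (_<? T) (L v))
                    (take-isKSubset k (rich v∈X) (filter⁺ (_<? T) (proj₁ (hL v∈P))))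
  ... | no  v∉X = isKSubset-⊆ (filter-⊆ (∁? (_<? T)) (L v)) (Rest.sublist-isKSubset (∈R v∈P v∉X))

  low : ∀ {v c} → c ∈ₗ take k (below T (L v)) → c < T
  low {v} c∈ = proj₂ (∈-filter⁻ (_<? T) {xs = L v} (take-⊆ k (below T (L v)) c∈))

  high : ∀ {v c} → v ∈ R → c ∈ₗ Rest.sublist v → ¬ c < T
  high {v} v∈R c∈ = proj₂ (∈-filter⁻ (∁? (_<? T)) {xs = L v} (proj₂ (Rest.sublist-isKSubset v∈R) c∈))

  sublist-disjoint : ∀ {u v} → u ∈ P → v ∈ P → part u ≢ part v → Disjoint (sublist u) (sublist v)
  sublist-disjoint {u} {v} u∈P v∈P part≢ with u ∈? X | v ∈? X
  ... | yes _   | yes _   = ⊥-elim (part≢ refl)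
  ... | yes _   | no  v∉X = λ (c∈u , c∈v) → high (∈R v∈P v∉X) c∈v (low c∈u)
  ... | no  u∉X | yes _   = λ (c∈u , c∈v) → high (∈R u∈P u∉X) c∈u (low c∈v)
  ... | no  u∉X | no  v∉X = Rest.sublist-disjoint (∈R u∈P u∉X) (∈R v∈P v∉X) (part≢ ∘ cong suc)

record Refinement (k : ℕ) (G : Graph) {r : ℕ} (V : Fin r → Subset (N G))
                  (L : Fin (N G) → List ℕ) : Set where
  field
    {r′}        : ℕ
    V′          : Fin r′ → Subset (N G)
    S           : Fin (N G) → List ℕ
    admissible  : Admissible G k V′
    S-isKSubset : ∀ v → IsKSubset k (S v) (L v)
    edges       : ∀ {u v} → AddCliques G V u v → AddCliques G V′ u v ⊎ Disjoint (S u) (S v)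

refine : ∀ k m (G : Graph) {r} (V : Fin r → Subset (N G)) → Admissible G (k * suc m) V →
         (L : Fin (N G) → List ℕ) → IsListAssignment (k * suc m) L → Refinement k G V L
refine k m G {r} V (disjoint , small) L isLA = record
  { V′          = block ∘ indices
  ; S           = S
  ; admissible  = (λ ι ι′ ι≢ι′ _ v∈ v∈′ →
                    ι≢ι′ (remQuot-injective (suc m) (block-unique (indices ι) (indices ι′) v∈ v∈′)))
                , (λ ι → Sp.part-small (proj₁ (indices ι)) (proj₂ (indices ι)))
  ; S-isKSubset = S-isKSubset
  ; edges       = edges
  }
  where
  module Sp (i : Fin r) = Splitting
    (split k m L (V i) (small i) (λ {v} _ → proj₁ (isLA v) , ≤-reflexive (sym (proj₂ (isLA v)))))

  indices : Fin (r * suc m) → Fin r × Fin (suc m)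
  indices = remQuot (suc m)

  same-block : ∀ {i i′ v} → v ∈ V i → v ∈ V i′ → i ≡ i′
  same-block {i} {i′} v∈ v∈′ with i ≟ᶠ i′
  ... | yes i≡i′ = i≡i′
  ... | no  i≢i′ = ⊥-elim (disjoint i i′ i≢i′ _ v∈ v∈′)

  block : Fin r × Fin (suc m) → Subset (N G)
  block (i , j) = V i ∩ select (λ v → Sp.part i v ≟ᶠ j)

  block-unique : ∀ b b′ {v} → v ∈ block b → v ∈ block b′ → b ≡ b′
  block-unique (i , j) (i′ , j′) v∈ v∈′
    with v∈Vi , in-j ← x∈p∩q⁻ (V i) _ v∈ | v∈Vi′ , in-j′ ← x∈p∩q⁻ (V i′) _ v∈′
    with refl ← same-block v∈Vi v∈Vi′
    = cong (i ,_) (trans (sym (∈-select⁻ (λ v → Sp.part i v ≟ᶠ j) in-j))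
                         (∈-select⁻ (λ v → Sp.part i v ≟ᶠ j′) in-j′))

  ∈-combine : ∀ {i j v} → v ∈ V i → Sp.part i v ≡ j → v ∈ block (indices (combine i j))
  ∈-combine {i} {j} v∈ e =
    subst (λ b → _ ∈ block b) (sym (remQuot-combine i j))
          (x∈p∩q⁺ (v∈ , ∈-select⁺ (λ v → Sp.part i v ≟ᶠ j) e))

  S : Fin (N G) → List ℕ
  S v with any? (λ i → v ∈? V i)
  ... | yes (i , _) = Sp.sublist i v
  ... | no  _       = take k (L v)

  S-block : ∀ {i v} → v ∈ V i → S v ≡ Sp.sublist i v
  S-block {i} {v} v∈ with any? (λ i → v ∈? V i)
  ... | yes (i′ , v∈′) with refl ← same-block v∈′ v∈ = refl
  ... | no  v∉       = ⊥-elim (v∉ (i , v∈))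

  S-isKSubset : ∀ v → IsKSubset k (S v) (L v)
  S-isKSubset v with any? (λ i → v ∈? V i)
  ... | yes (i , v∈) = Sp.sublist-isKSubset i v∈
  ... | no  _        = take-isKSubset k (≤-trans (m≤m*n k (suc m)) (≤-reflexive (sym (proj₂ (isLA v)))))
                                        (proj₁ (isLA v))

  edges : ∀ {u v} → AddCliques G V u v → AddCliques G (block ∘ indices) u v ⊎ Disjoint (S u) (S v)
  edges (inj₁ u~v) = inj₁ (inj₁ u~v)
  edges {u} {v} (inj₂ (u≢v , i , u∈ , v∈)) with Sp.part i u ≟ᶠ Sp.part i v
  ... | yes same =
    inj₁ (inj₂ (u≢v , combine i (Sp.part i u) , ∈-combine u∈ refl , ∈-combine v∈ (sym same)))
  ... | no  different =
    inj₂ (subst₂ Disjoint (sym (S-block u∈)) (sym (S-block v∈)) (Sp.sublist-disjoint i u∈ v∈ different))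

theorem8 : (k : ℕ) → k ≥ 1 → (G : Graph) → StronglyChoosable k G →
    (m : ℕ) → m ≥ 1 → StronglyChoosable (k * m) G
theorem8 k _ G strong (suc m) _ r V adm L isLA = c , c∈L , proper
  where
  open Refinement (refine k m G V adm L isLA)

  colouring : Σ (Fin (N G) → ℕ) λ c →
                (∀ v → c v ∈ₗ S v) × (∀ u v → AddCliques G V′ u v → c u ≢ c v)
  colouring = strong r′ V′ admissible S (proj₁ ∘ S-isKSubset)

  c : Fin (N G) → ℕ
  c = proj₁ colouring

  c∈S : ∀ v → c v ∈ₗ S v
  c∈S = proj₁ (proj₂ colouring)

  c∈L : ∀ v → c v ∈ₗ L v
  c∈L v = proj₂ (S-isKSubset v) (c∈S v)

  proper : ∀ u v → AddCliques G V u v → c u ≢ c v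
  proper u v u~v = [ proj₂ (proj₂ colouring) u v , apart ]′ (edges u~v)
    where
    apart : Disjoint (S u) (S v) → c u ≢ c v
    apart disjoint cu≡cv = disjoint (c∈S u , subst (_∈ₗ S v) (sym cu≡cv) (c∈S v))
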